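{- Let $k=k(n)$ be integers with $1\le k(n)\le (n+1)/2$, and let $s(n,k)$ denote the minimum size of a full squashed flat antichain in $\binom{[n]}k\cup\binom{[n]}{k-1}$. Then $s(n,k)=(1+o(1))\binom{n}{k-1}$ as $n\to\infty$.
   Context: $[n]=\{1,\dots,n\}$, $\binom{[n]}{i}$ is the family of $i$-subsets of $[n]$. Squashed (colexicographic) order: for distinct $F,G\subseteq[n]$, $F<_S G$ iff $\max\bigl((F\cup G)\setminus(F\cap G)\bigr)\in G$. For $\mathcal{G}\subseteq\binom{[n]}{i}$, the shadow is $\Delta\mathcal{G}=\{H\in\binom{[n]}{i-1}: H\subset G \text{ for some } G\in\mathcal{G}\}$. A full squashed flat antichain in $\binom{[n]}k\cup\binom{[n]}{k-1}$ is a family $\mathcal{A}\cup\mathcal{B}$ where, for some $0\le m\le\binom nk$, $\mathcal{A}$ is the set of the first $m$ elements of $\binom{[n]}{k}$ in squashed order and $\mathcal{B}=\binom{[n]}{k-1}\setminus\Delta\mathcal{A}$; its size is $|\mathcal{A}|+|\mathcal{B}|$. -}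

module Defs where

open import Data.Nat as ℕ using (ℕ; zero; suc; _+_; _∸_; _⊓_)
open import Data.Nat.Properties as ℕP using ()
open import Data.Fin as Fin using (Fin)
open import Data.Fin.Properties as FinP using (any?; all?)
open import Data.Fin.Subset using (Subset; _∈_; _∉_; _⊆_; ∣_∣; inside; outside)
open import Data.Fin.Subset.Properties using (_∈?_; _⊆?_)
open import Data.Vec using (_∷_; [])
open import Data.List using (List; []; _∷_; _++_; map; filter; length; foldr; upTo)
open import Data.List.Relation.Unary.Any using (Any)
import Data.List.Relation.Unary.Any as Any
open import Data.Product using (Σ; _×_; _,_)
open import Relation.Nullary using (Dec; ¬_; ¬?; _×-dec_; _→-dec_)
open import Relation.Binary.PropositionalEquality using (_≡_)
open import Data.Nat.Combinatorics using (_C_)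

-- Subsets of [n] = {1,…,n} are represented by Subset n = Vec Bool n over Fin n,
-- where the element i ∈ [n] corresponds to the index i-1 : Fin n (order preserved).

allSubsets : (n : ℕ) → List (Subset n)
allSubsets zero = [] ∷ []
allSubsets (suc n) = map (outside ∷_) (allSubsets n) ++ map (inside ∷_) (allSubsets n)

layer : (n i : ℕ) → List (Subset n)
layer n i = filter (λ F → ∣ F ∣ ℕ.≟ i) (allSubsets n)

-- Squashed (colex) order: F <S G iff the maximum of the symmetric difference
-- of F and G lies in G, i.e. there is x ∈ G \ F such that no y > x lies in
-- the symmetric difference.
_<S_ : {n : ℕ} → Subset n → Subset n → Set
_<S_ {n} F G = Σ (Fin n) λ x → x ∈ G × x ∉ F ×
  ((y : Fin n) → x Fin.< y → ((y ∈ F → y ∈ G) × (y ∈ G → y ∈ F)))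

_<S?_ : {n : ℕ} → (F G : Subset n) → Dec (F <S G)
F <S? G = any? λ x → (x ∈? G) ×-dec (¬? (x ∈? F)) ×-dec
  all? (λ y → (x FinP.<? y) →-dec (((y ∈? F) →-dec (y ∈? G)) ×-dec ((y ∈? G) →-dec (y ∈? F))))

rankS : (n k : ℕ) → Subset n → ℕ
rankS n k F = length (filter (λ G → G <S? F) (layer n k))

firstS : (n k m : ℕ) → List (Subset n)
firstS n k m = filter (λ F → rankS n k F ℕ.<? m) (layer n k)

-- 𝓑 = binom([n], k-1) \ Δ𝒜.  (For H of size k-1 and G of size k, H ⊆ G is H ⊂ G.)
complShadow : (n k m : ℕ) → List (Subset n)
complShadow n k m =
  filter (λ H → ¬? (Any.any? (λ G → H ⊆? G) (firstS n k m))) (layer n (k ∸ 1))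

fsfaSize : (n k m : ℕ) → ℕ
fsfaSize n k m = length (firstS n k m) + length (complShadow n k m)

s : (n k : ℕ) → ℕ
s n k = foldr _⊓_ (fsfaSize n k 0) (map (fsfaSize n k) (upTo (suc (n C k))))

-- Taking m = 0 shows s(n,k) ≤ C(n,k−1). Conversely the antichain with parameter m has size
-- |𝒜| + C(n,k−1) − |Δ𝒜|, so it suffices to bound the excess |Δ𝒜| − |𝒜| of initial segments of the
-- squashed order. Splitting k-subsets of [n+1] by whether they contain n+1 gives a recursive bound on
-- the excess, and the identity (k+1)(C(x,k) − C(x,k+1)) = (2k+1−x)·C(x,k) ≤ C(2k,k) turns it into
-- k·excess ≤ 2·C(2k−2,k−1). For 2k ≤ n+1 this is at most (2/k)·C(n,k−1) when k is large and bounded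
-- when k is small, hence o(C(n,k−1)).

module Submission where

open import Defs
open import Level using (Level)
open import Data.Empty using (⊥-elim)
open import Data.Fin as Fin using (Fin; fromℕ; inject₁)
open import Data.Fin.Properties using (toℕ-inject₁; toℕ-fromℕ; toℕ≤pred[n]; toℕ<n)
open import Data.Fin.Subset using (Subset; _∈_; _⊆_; ∣_∣; inside; outside)
open import Data.Fin.Subset.Properties using (_⊆?_)
open import Data.List using (List; []; _∷_; _++_; map; filter; length; upTo)
open import Data.List.Membership.Propositional using (find; lose) renaming (_∈_ to _∈ₗ_)
open import Data.List.Membership.Propositional.Properties
  using (∈-++⁺ˡ; ∈-++⁺ʳ; ∈-map⁺; ∈-filter⁺; ∈-filter⁻)
open import Data.List.Properties
  using (length-filter; length-++; filter-++; filter-notAll; foldr-preservesʳ; foldr-preservesᵇ)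
open import Data.List.Relation.Unary.All using (universal)
open import Data.List.Relation.Unary.All.Properties using (map⁺)
open import Data.List.Relation.Unary.Any using (Any; here; there; any?)
open import Data.Nat using (ℕ; zero; suc; _+_; _*_; _∸_; _⊔_; ∣_-_∣; _≤_; _<_; _≟_; _<?_; _≤?_; z≤n; s≤s)
open import Data.Nat.Combinatorics
  using (_C_; nCk+nC[k+1]≡[n+1]C[k+1]; nC1≡n; k>n⇒nCk≡0; nCk≡nC[n∸k])
open import Data.Nat.Properties
open import Algebra.Properties.CommutativeSemigroup +-commutativeSemigroup
  using (interchange; x∙yz≈y∙xz; x∙yz≈yx∙z; xy∙z≈xz∙y)
open import Data.Nat.Tactic.RingSolver using (solve-∀)
open import Data.Product using (_×_; _,_; proj₁; proj₂; ∃-syntax)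
open import Data.Vec using ([]; _∷_; _∷ʳ_; here; there; initLast)
open import Function using (_∘_; _⇔_; mk⇔; Equivalence)
open import Relation.Binary.PropositionalEquality
open import Relation.Nullary using (¬_; yes; no; ¬?; _×-dec_)
open import Relation.Nullary.Negation using (contradiction)
open import Relation.Unary using (Pred; Decidable)
open import Relation.Unary.Properties using (_∩?_)

open Equivalence using (to; from)

private variable
  ℓ p q : Level
  A B : Set ℓ
  n : ℕ

module _ {P : Pred A p} {Q : Pred A q} (P? : Decidable P) (Q? : Decidable Q) where

  length-filter-mono : (∀ x → P x → Q x) → ∀ xs → length (filter P? xs) ≤ length (filter Q? xs)
  length-filter-mono P⇒Q [] = z≤n
  length-filter-mono P⇒Q (x ∷ xs) with P? x | Q? x
  ... | yes _  | yes _  = s≤s (length-filter-mono P⇒Q xs)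
  ... | yes px | no ¬qx = ⊥-elim (¬qx (P⇒Q x px))
  ... | no _   | yes _  = m≤n⇒m≤1+n (length-filter-mono P⇒Q xs)
  ... | no _   | no _   = length-filter-mono P⇒Q xs

  length-filter-filter : ∀ xs → length (filter P? (filter Q? xs)) ≡ length (filter (Q? ∩? P?) xs)
  length-filter-filter [] = refl
  length-filter-filter (x ∷ xs) with Q? x
  ... | no _ = length-filter-filter xs
  ... | yes _ with P? x
  ...   | yes _ = cong suc (length-filter-filter xs)
  ...   | no _  = length-filter-filter xs

module _ {P : Pred A p} {Q : Pred A q} (P? : Decidable P) (Q? : Decidable Q) where

  length-filter-⇔ : (∀ x → P x ⇔ Q x) → ∀ xs → length (filter P? xs) ≡ length (filter Q? xs)
  length-filter-⇔ P⇔Q xs = ≤-antisym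
    (length-filter-mono P? Q? (to ∘ P⇔Q) xs) (length-filter-mono Q? P? (from ∘ P⇔Q) xs)

module _ {P : Pred A p} (P? : Decidable P) where

  length-filter-none : (∀ x → ¬ P x) → ∀ xs → length (filter P? xs) ≡ 0
  length-filter-none ¬P [] = refl
  length-filter-none ¬P (x ∷ xs) with P? x
  ... | yes px = ⊥-elim (¬P x px)
  ... | no _   = length-filter-none ¬P xs

  length-filter+length-filter-¬ : ∀ xs → length (filter P? xs) + length (filter (¬? ∘ P?) xs) ≡ length xs
  length-filter+length-filter-¬ [] = refl
  length-filter+length-filter-¬ (x ∷ xs) with P? x
  ... | yes _ = cong suc (length-filter+length-filter-¬ xs)
  ... | no _  = trans (+-suc _ _) (cong suc (length-filter+length-filter-¬ xs))

  length-filter-map : (f : B → A) → ∀ xs → length (filter P? (map f xs)) ≡ length (filter (P? ∘ f) xs)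
  length-filter-map f [] = refl
  length-filter-map f (x ∷ xs) with P? (f x)
  ... | yes _ = cong suc (length-filter-map f xs)
  ... | no _  = length-filter-map f xs

m+n<o⇔n<o∸m : ∀ m {n o} → m + n < o ⇔ n < o ∸ m
m+n<o⇔n<o∸m m = mk⇔ (to′ m) (from′ m)
  where
  to′ : ∀ m {n o} → m + n < o → n < o ∸ m
  to′ zero lt = lt
  to′ (suc m) {o = suc o} (s≤s lt) = to′ m lt
  from′ : ∀ m {n o} → n < o ∸ m → m + n < o
  from′ zero lt = lt
  from′ (suc m) {o = suc o} lt = s≤s (from′ m lt)

m∸[n∸o]≡[m+o]∸n : ∀ m {n o} → o ≤ n → m ∸ (n ∸ o) ≡ (m + o) ∸ n
m∸[n∸o]≡[m+o]∸n m {o = o} o≤n with d , refl ← m≤n⇒∃[o]m+o≡n o≤n = begin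
  m ∸ ((o + d) ∸ o)    ≡⟨ cong (m ∸_) (m+n∸m≡n o d) ⟩
  m ∸ d                ≡⟨ [m+n]∸[m+o]≡n∸o o m d ⟨
  (o + m) ∸ (o + d)    ≡⟨ cong (_∸ (o + d)) (+-comm o m) ⟩
  (m + o) ∸ (o + d) ∎
  where open ≡-Reasoning

[m+n]∸o≤[m∸o]+n : ∀ m n o → (m + n) ∸ o ≤ (m ∸ o) + n
[m+n]∸o≤[m∸o]+n m n o = m≤n+o⇒m∸n≤o (m + n) o (begin
  m + n                ≤⟨ +-monoˡ-≤ n (m≤n+m∸n m o) ⟩
  (o + (m ∸ o)) + n    ≡⟨ +-assoc o (m ∸ o) n ⟩
  o + ((m ∸ o) + n) ∎)
  where open ≤-Reasoning

m+[n+o]≤[p+n]+[q⊔[m+o∸p]] : ∀ m n o p q → m + (n + o) ≤ (p + n) + (q ⊔ (m + o ∸ p))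
m+[n+o]≤[p+n]+[q⊔[m+o∸p]] m n o p q = begin
  m + (n + o)             ≡⟨ x∙yz≈y∙xz m n o ⟩
  n + (m + o)             ≤⟨ +-monoʳ-≤ n (m≤n+m∸n (m + o) p) ⟩
  n + (p + (m + o ∸ p))   ≡⟨ x∙yz≈yx∙z n p _ ⟩
  (p + n) + (m + o ∸ p)   ≤⟨ +-monoʳ-≤ (p + n) (m≤n⊔m q _) ⟩
  (p + n) + (q ⊔ (m + o ∸ p)) ∎
  where open ≤-Reasoning

2*[i+2]≤1+n⇒[i+1]+[i+1]≤n : ∀ i {n} → 2 * suc (suc i) ≤ suc n → suc i + suc i ≤ n
2*[i+2]≤1+n⇒[i+1]+[i+1]≤n i {n} le = <⇒≤ (≤-pred (subst (_≤ suc n) (ring i) le))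
  where
  ring : ∀ i → 2 * suc (suc i) ≡ suc (suc (suc i + suc i))
  ring = solve-∀

C-pascal : ∀ n k → suc n C suc k ≡ n C k + n C suc k
C-pascal n k = sym (nCk+nC[k+1]≡[n+1]C[k+1] n k)

[k+1]*[n+1]C[k+1]≡[n+1]*nCk : ∀ n k → suc k * (suc n C suc k) ≡ suc n * (n C k)
[k+1]*[n+1]C[k+1]≡[n+1]*nCk zero zero = refl
[k+1]*[n+1]C[k+1]≡[n+1]*nCk zero (suc k) = *-zeroʳ (suc (suc k))
[k+1]*[n+1]C[k+1]≡[n+1]*nCk (suc n) zero =
  trans (+-identityʳ _) (trans (nC1≡n (suc (suc n))) (sym (*-identityʳ _)))
[k+1]*[n+1]C[k+1]≡[n+1]*nCk (suc n) (suc k) = begin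
  suc (suc k) * (suc (suc n) C suc (suc k))
    ≡⟨ cong (suc (suc k) *_) (C-pascal (suc n) (suc k)) ⟩
  suc (suc k) * (a + suc n C suc (suc k))
    ≡⟨ *-distribˡ-+ (suc (suc k)) a _ ⟩
  (a + suc k * a) + suc (suc k) * (suc n C suc (suc k))
    ≡⟨ cong₂ (λ y z → (a + y) + z)
         ([k+1]*[n+1]C[k+1]≡[n+1]*nCk n k) ([k+1]*[n+1]C[k+1]≡[n+1]*nCk n (suc k)) ⟩
  (a + suc n * (n C k)) + suc n * (n C suc k)
    ≡⟨ +-assoc a _ _ ⟩
  a + (suc n * (n C k) + suc n * (n C suc k))
    ≡⟨ cong (a +_) (*-distribˡ-+ (suc n) (n C k) (n C suc k)) ⟨
  a + suc n * (n C k + n C suc k)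
    ≡⟨ cong (λ z → a + suc n * z) (C-pascal n k) ⟨
  suc (suc n) * a ∎
  where
  open ≡-Reasoning
  a = suc n C suc k

[k+1]*nC[k+1]+k*nCk≡n*nCk : ∀ n k → suc k * (n C suc k) + k * (n C k) ≡ n * (n C k)
[k+1]*nC[k+1]+k*nCk≡n*nCk zero zero = refl
[k+1]*nC[k+1]+k*nCk≡n*nCk zero (suc k) = cong₂ _+_ (*-zeroʳ (suc (suc k))) (*-zeroʳ (suc k))
[k+1]*nC[k+1]+k*nCk≡n*nCk (suc n) zero =
  trans (+-identityʳ _) (trans (+-identityʳ _) (trans (nC1≡n (suc n)) (sym (*-identityʳ _))))
[k+1]*nC[k+1]+k*nCk≡n*nCk (suc n) (suc k) = begin
  suc (suc k) * (suc n C suc (suc k)) + suc k * (suc n C suc k)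
    ≡⟨ cong₂ _+_ ([k+1]*[n+1]C[k+1]≡[n+1]*nCk n (suc k)) ([k+1]*[n+1]C[k+1]≡[n+1]*nCk n k) ⟩
  suc n * (n C suc k) + suc n * (n C k)
    ≡⟨ *-distribˡ-+ (suc n) (n C suc k) (n C k) ⟨
  suc n * (n C suc k + n C k)
    ≡⟨ cong (suc n *_) (trans (+-comm (n C suc k) (n C k)) (sym (C-pascal n k))) ⟩
  suc n * (suc n C suc k) ∎
  where open ≡-Reasoning

[s+1]*[k+s+1]Ck≡[k+s+1]*[k+s]Ck : ∀ k s → suc s * (suc (k + s) C k) ≡ suc (k + s) * ((k + s) C k)
[s+1]*[k+s+1]Ck≡[k+s+1]*[k+s]Ck k s = +-cancelʳ-≡ (k * c′) _ _ (begin
  suc s * c′ + k * c′             ≡⟨ *-distribʳ-+ c′ (suc s) k ⟨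
  (suc s + k) * c′                ≡⟨ cong (_* c′) (+-comm (suc s) k) ⟩
  (k + suc s) * c′                ≡⟨ cong (_* c′) (+-suc k s) ⟩
  suc (k + s) * c′                ≡⟨ [k+1]*nC[k+1]+k*nCk≡n*nCk (suc (k + s)) k ⟨
  suc k * (suc (k + s) C suc k) + k * c′
    ≡⟨ cong (_+ k * c′) ([k+1]*[n+1]C[k+1]≡[n+1]*nCk (k + s) k) ⟩
  suc (k + s) * ((k + s) C k) + k * c′ ∎)
  where
  open ≡-Reasoning
  c′ = suc (k + s) C k

gap : ℕ → ℕ → ℕ
gap k x = (suc (k + k) ∸ x) * (x C k)

-- With k = s+t+1 and x = k+s, gap k (x+1) / gap k x = (t+1)(x+1) / ((t+2)(s+1)) ≥ 1.
gap-step-above : ∀ s t → let k = suc (s + t) in gap k (k + s) ≤ gap k (suc (k + s))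
gap-step-above s t = *-cancelˡ-≤ (suc s) (begin
  suc s * gap k x                    ≡⟨ cong (λ z → suc s * (z * c)) (top-gap x (suc (suc t)) (ring₁ s t)) ⟩
  suc s * (suc (suc t) * c)          ≤⟨ m≤m+n _ (t * (s + t + 2) * c) ⟩
  suc s * (suc (suc t) * c) + t * (s + t + 2) * c
                                     ≡⟨ ring₂ s t c ⟩
  suc t * (suc x * c)                ≡⟨ cong (suc t *_) ([s+1]*[k+s+1]Ck≡[k+s+1]*[k+s]Ck k s) ⟨
  suc t * (suc s * c′)               ≡⟨ ring₃ s t c′ ⟩
  suc s * (suc t * c′)               ≡⟨ cong (λ z → suc s * (z * c′)) (top-gap (suc x) (suc t) (ring₄ s t)) ⟨
  suc s * gap k (suc x) ∎)
  where
  open ≤-Reasoning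
  k = suc (s + t)
  x = k + s
  c = x C k
  c′ = suc x C k
  top-gap : ∀ y d → suc (k + k) ≡ y + d → suc (k + k) ∸ y ≡ d
  top-gap y d eq = trans (cong (_∸ y) eq) (m+n∸m≡n y d)
  ring₁ : ∀ s t → suc (suc (s + t) + suc (s + t)) ≡ (suc (s + t) + s) + suc (suc t)
  ring₁ = solve-∀
  ring₂ : ∀ s t c → suc s * (suc (suc t) * c) + t * (s + t + 2) * c ≡ suc t * (suc (suc (s + t) + s) * c)
  ring₂ = solve-∀
  ring₃ : ∀ s t c → suc t * (suc s * c) ≡ suc s * (suc t * c)
  ring₃ = solve-∀
  ring₄ : ∀ s t → suc (suc (s + t) + suc (s + t)) ≡ suc (suc (s + t) + s) + suc t
  ring₄ = solve-∀

gap-step : ∀ k x → x < k + k → gap k x ≤ gap k (suc x)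
gap-step k x x<2k with x <? k
... | yes x<k rewrite k>n⇒nCk≡0 x<k | *-zeroʳ (suc (k + k) ∸ x) = z≤n
... | no x≮k with s , refl ← m≤n⇒∃[o]m+o≡n (≮⇒≥ x≮k)
             with t , refl ← m≤n⇒∃[o]m+o≡n (+-cancelˡ-< k s k x<2k) = gap-step-above s t

gap≤gap[k+k] : ∀ k x d → x + d ≡ k + k → gap k x ≤ gap k (k + k)
gap≤gap[k+k] k x zero eq = ≤-reflexive (cong (gap k) (trans (sym (+-identityʳ x)) eq))
gap≤gap[k+k] k x (suc d) eq = ≤-trans (gap-step k x (subst (x <_) eq (m<m+n x (s≤s z≤n))))
  (gap≤gap[k+k] k (suc x) d (trans (sym (+-suc x d)) eq))

gap[k+k]≡[k+k]Ck : ∀ k → gap k (k + k) ≡ (k + k) C k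
gap[k+k]≡[k+k]Ck k = begin
  (suc (k + k) ∸ (k + k)) * ((k + k) C k)  ≡⟨ cong (λ z → (z ∸ (k + k)) * ((k + k) C k)) (+-comm 1 (k + k)) ⟩
  ((k + k + 1) ∸ (k + k)) * ((k + k) C k)  ≡⟨ cong (_* ((k + k) C k)) (m+n∸m≡n (k + k) 1) ⟩
  1 * ((k + k) C k)                       ≡⟨ *-identityˡ _ ⟩
  (k + k) C k ∎
  where open ≡-Reasoning

gap≤[k+k]Ck : ∀ k x → gap k x ≤ (k + k) C k
gap≤[k+k]Ck k x with x ≤? k + k
... | yes x≤2k with d , eq ← m≤n⇒∃[o]m+o≡n x≤2k =
  ≤-trans (gap≤gap[k+k] k x d eq) (≤-reflexive (gap[k+k]≡[k+k]Ck k))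
... | no x≰2k rewrite m≤n⇒m∸n≡0 (≰⇒> x≰2k) = z≤n

k*nCk≤n*nCk : ∀ k n → k * (n C k) ≤ n * (n C k)
k*nCk≤n*nCk k n with n <? k
... | yes n<k rewrite k>n⇒nCk≡0 n<k | *-zeroʳ k = z≤n
... | no n≮k = *-monoˡ-≤ (n C k) (≮⇒≥ n≮k)

[k+1]*[nCk∸nC[k+1]]≡gap : ∀ k n → suc k * (n C k ∸ n C suc k) ≡ gap k n
[k+1]*[nCk∸nC[k+1]]≡gap k n = begin
  suc k * (c ∸ c′)                  ≡⟨ *-distribˡ-∸ (suc k) c c′ ⟩
  suc k * c ∸ suc k * c′            ≡⟨ cong (suc k * c ∸_) [k+1]c′≡nc∸kc ⟩
  suc k * c ∸ (n * c ∸ k * c)       ≡⟨ m∸[n∸o]≡[m+o]∸n (suc k * c) (k*nCk≤n*nCk k n) ⟩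
  (suc k * c + k * c) ∸ n * c       ≡⟨ cong (_∸ n * c) (*-distribʳ-+ c (suc k) k) ⟨
  suc (k + k) * c ∸ n * c           ≡⟨ *-distribʳ-∸ c (suc (k + k)) n ⟨
  gap k n ∎
  where
  open ≡-Reasoning
  c = n C k
  c′ = n C suc k
  [k+1]c′≡nc∸kc : suc k * c′ ≡ n * c ∸ k * c
  [k+1]c′≡nc∸kc = trans (sym (m+n∸n≡m (suc k * c′) (k * c)))
                         (cong (_∸ k * c) ([k+1]*nC[k+1]+k*nCk≡n*nCk n k))

[i+1]*[2i+2]C[i+1]≡2*[2i+1]*[2i]Ci : ∀ i → suc i * ((suc i + suc i) C suc i) ≡ 2 * suc (i + i) * ((i + i) C i)
[i+1]*[2i+2]C[i+1]≡2*[2i+1]*[2i]Ci i = *-cancelˡ-≡ _ _ (suc i) (begin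
  suc i * (suc i * ((suc i + suc i) C suc i))
    ≡⟨ cong (λ z → suc i * (suc i * (z C suc i))) (+-suc (suc i) i) ⟩
  suc i * (suc i * (suc (suc c) C suc i))
    ≡⟨ cong (suc i *_) ([k+1]*[n+1]C[k+1]≡[n+1]*nCk (suc c) i) ⟩
  suc i * (suc (suc c) * (suc c C i))
    ≡⟨ cong (λ z → suc i * (suc (suc c) * z)) middle-symmetric ⟨
  suc i * (suc (suc c) * (suc c C suc i))
    ≡⟨ ring₁ i (suc c C suc i) ⟩
  suc (suc c) * (suc i * (suc c C suc i))
    ≡⟨ cong (suc (suc c) *_) ([k+1]*[n+1]C[k+1]≡[n+1]*nCk c i) ⟩
  suc (suc c) * (suc c * (c C i))
    ≡⟨ ring₂ i (c C i) ⟩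
  suc i * (2 * suc c * (c C i)) ∎)
  where
  open ≡-Reasoning
  c = i + i
  middle-symmetric : suc c C suc i ≡ suc c C i
  middle-symmetric = trans (nCk≡nC[n∸k] (s≤s (m≤n+m i i))) (cong (suc c C_) (m+n∸n≡m i i))
  ring₁ : ∀ i b → suc i * (suc (suc (i + i)) * b) ≡ suc (suc (i + i)) * (suc i * b)
  ring₁ = solve-∀
  ring₂ : ∀ i b → suc (suc (i + i)) * (suc (i + i) * b) ≡ suc i * (2 * suc (i + i) * b)
  ring₂ = solve-∀

nCk≤[n+1]Ck : ∀ n k → n C k ≤ suc n C k
nCk≤[n+1]Ck n zero = ≤-refl
nCk≤[n+1]Ck n (suc k) = ≤-trans (m≤n+m (n C suc k) (n C k)) (≤-reflexive (sym (C-pascal n k)))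

C-monoˡ-≤ : ∀ k {m n} → m ≤ n → m C k ≤ n C k
C-monoˡ-≤ k {m} m≤n with d , refl ← m≤n⇒∃[o]m+o≡n m≤n = go m d
  where
  go : ∀ m d → m C k ≤ (m + d) C k
  go m zero = ≤-reflexive (cong (_C k) (sym (+-identityʳ m)))
  go m (suc d) = ≤-trans (nCk≤[n+1]Ck m k)
    (≤-trans (go (suc m) d) (≤-reflexive (cong (_C k) (sym (+-suc m d)))))

[k+k]Ck≤[k+1+k+1]C[k+1] : ∀ k → (k + k) C k ≤ (suc k + suc k) C suc k
[k+k]Ck≤[k+1+k+1]C[k+1] k = begin
  (k + k) C k            ≤⟨ C-monoˡ-≤ k (+-monoʳ-≤ k (n≤1+n k)) ⟩
  (k + suc k) C k        ≤⟨ m≤m+n _ _ ⟩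
  (k + suc k) C k + (k + suc k) C suc k  ≡⟨ C-pascal (k + suc k) k ⟨
  (suc k + suc k) C suc k ∎
  where open ≤-Reasoning

central-mono-≤ : ∀ {a b} → a ≤ b → (a + a) C a ≤ (b + b) C b
central-mono-≤ {a} a≤b with d , refl ← m≤n⇒∃[o]m+o≡n a≤b = go a d
  where
  go : ∀ a d → (a + a) C a ≤ ((a + d) + (a + d)) C (a + d)
  go a zero rewrite +-identityʳ a = ≤-refl
  go a (suc d) = ≤-trans ([k+k]Ck≤[k+1+k+1]C[k+1] a)
    (subst (λ z → (suc a + suc a) C suc a ≤ (z + z) C z) (sym (+-suc a d)) (go (suc a) d))

0<nCk : ∀ {n k} → k ≤ n → 0 < n C k
0<nCk {k = zero} _ = s≤s z≤n
0<nCk {suc n} {suc k} (s≤s k≤n) =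
  ≤-trans (0<nCk k≤n) (≤-trans (m≤m+n _ _) (≤-reflexive (sym (C-pascal n k))))

n≤nCk : ∀ {n k} → 1 ≤ k → k < n → n ≤ n C k
n≤nCk {suc n} {suc zero} _ _ = ≤-reflexive (sym (nC1≡n (suc n)))
n≤nCk {suc n} {suc (suc k)} _ (s≤s k+1<n) = begin
  suc n                       ≡⟨ +-comm 1 n ⟩
  n + 1                       ≤⟨ +-mono-≤ (n≤nCk (s≤s z≤n) k+1<n) (0<nCk k+1<n) ⟩
  n C suc k + n C suc (suc k) ≡⟨ C-pascal n (suc k) ⟨
  suc n C suc (suc k) ∎
  where open ≤-Reasoning

count : (n : ℕ) {P : Pred (Subset n) p} → Decidable P → ℕ
count n P? = length (filter P? (allSubsets n))

count-∷ : ∀ n {P : Pred (Subset (suc n)) p} (P? : Decidable P) →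
  count (suc n) P? ≡ count n (P? ∘ (outside ∷_)) + count n (P? ∘ (inside ∷_))
count-∷ n P? = begin
  count (suc n) P?
    ≡⟨ cong length (filter-++ P? (map (outside ∷_) (allSubsets n)) _) ⟩
  length (filter P? (map (outside ∷_) (allSubsets n)) ++ filter P? (map (inside ∷_) (allSubsets n)))
    ≡⟨ length-++ (filter P? (map (outside ∷_) (allSubsets n))) ⟩
  _ ≡⟨ cong₂ _+_ (length-filter-map P? _ (allSubsets n)) (length-filter-map P? _ (allSubsets n)) ⟩
  count n (P? ∘ (outside ∷_)) + count n (P? ∘ (inside ∷_)) ∎
  where open ≡-Reasoning

-- Squashed order is decided at the largest elements, so subsets of [n+1] are split as F ∷ʳ b,
-- where b records whether the top element n+1 (the index fromℕ n) belongs to the set.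
count-∷ʳ : ∀ n {P : Pred (Subset (suc n)) p} (P? : Decidable P) →
  count (suc n) P? ≡ count n (P? ∘ (_∷ʳ outside)) + count n (P? ∘ (_∷ʳ inside))
count-∷ʳ zero P? with P? (outside ∷ [])
... | yes _ with P? (inside ∷ [])
...   | yes _ = refl
...   | no _  = refl
count-∷ʳ zero P? | no _ with P? (inside ∷ [])
...   | yes _ = refl
...   | no _  = refl
count-∷ʳ (suc n) P? = begin
  count (suc (suc n)) P?
    ≡⟨ count-∷ (suc n) P? ⟩
  count (suc n) (P? ∘ (outside ∷_)) + count (suc n) (P? ∘ (inside ∷_))
    ≡⟨ cong₂ _+_ (count-∷ʳ n (P? ∘ (outside ∷_))) (count-∷ʳ n (P? ∘ (inside ∷_))) ⟩
  (count n (P? ∘ (outside ∷_) ∘ (_∷ʳ outside)) + count n (P? ∘ (outside ∷_) ∘ (_∷ʳ inside))) +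
  (count n (P? ∘ (inside ∷_) ∘ (_∷ʳ outside)) + count n (P? ∘ (inside ∷_) ∘ (_∷ʳ inside)))
    ≡⟨ interchange (count n (P? ∘ (outside ∷_) ∘ (_∷ʳ outside))) _ _ _ ⟩
  (count n (P? ∘ (outside ∷_) ∘ (_∷ʳ outside)) + count n (P? ∘ (inside ∷_) ∘ (_∷ʳ outside))) +
  (count n (P? ∘ (outside ∷_) ∘ (_∷ʳ inside)) + count n (P? ∘ (inside ∷_) ∘ (_∷ʳ inside)))
    ≡⟨ sym (cong₂ _+_ (count-∷ n (P? ∘ (_∷ʳ outside))) (count-∷ n (P? ∘ (_∷ʳ inside)))) ⟩
  count (suc n) (P? ∘ (_∷ʳ outside)) + count (suc n) (P? ∘ (_∷ʳ inside)) ∎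
  where open ≡-Reasoning

∈-allSubsets : ∀ {n} (F : Subset n) → F ∈ₗ allSubsets n
∈-allSubsets [] = here refl
∈-allSubsets {suc n} (outside ∷ F) = ∈-++⁺ˡ (∈-map⁺ (outside ∷_) (∈-allSubsets F))
∈-allSubsets {suc n} (inside ∷ F) =
  ∈-++⁺ʳ (map (outside ∷_) (allSubsets n)) (∈-map⁺ (inside ∷_) (∈-allSubsets F))

length-layer : ∀ n k → length (layer n k) ≡ n C k
length-layer zero zero = refl
length-layer zero (suc k) = refl
length-layer (suc n) zero = trans (count-∷ n (λ F → ∣ F ∣ ≟ 0))
  (cong₂ _+_ (length-layer n 0) (length-filter-none (λ F → suc ∣ F ∣ ≟ 0) (λ _ ()) (allSubsets n)))
length-layer (suc n) (suc k) = begin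
  count (suc n) (λ F → ∣ F ∣ ≟ suc k)
    ≡⟨ count-∷ n (λ F → ∣ F ∣ ≟ suc k) ⟩
  count n (λ F → ∣ F ∣ ≟ suc k) + count n (λ F → suc ∣ F ∣ ≟ suc k)
    ≡⟨ cong (count n (λ F → ∣ F ∣ ≟ suc k) +_)
         (length-filter-⇔ _ (λ F → ∣ F ∣ ≟ k) (λ _ → mk⇔ suc-injective (cong suc)) (allSubsets n)) ⟩
  count n (λ F → ∣ F ∣ ≟ suc k) + count n (λ F → ∣ F ∣ ≟ k)
    ≡⟨ cong₂ _+_ (length-layer n (suc k)) (length-layer n k) ⟩
  n C suc k + n C k
    ≡⟨ +-comm (n C suc k) (n C k) ⟩
  n C k + n C suc k
    ≡⟨ C-pascal n k ⟨
  suc n C suc k ∎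
  where open ≡-Reasoning

data TopView {n : ℕ} : Fin (suc n) → Set where
  top   : TopView (fromℕ n)
  below : (i : Fin n) → TopView (inject₁ i)

topView : ∀ {n} (x : Fin (suc n)) → TopView x
topView {zero} Fin.zero = top
topView {suc n} Fin.zero = below Fin.zero
topView {suc n} (Fin.suc x) with topView x
... | top     = top
... | below i = below (Fin.suc i)

inject₁<fromℕ : ∀ {n} (i : Fin n) → inject₁ i Fin.< fromℕ n
inject₁<fromℕ {n} i rewrite toℕ-inject₁ i | toℕ-fromℕ n = toℕ<n i

fromℕ≮ : ∀ {n} (x : Fin (suc n)) → ¬ (fromℕ n Fin.< x)
fromℕ≮ {n} x lt rewrite toℕ-fromℕ n = <⇒≱ lt (toℕ≤pred[n] x)

inject₁-mono-< : ∀ {n} {i j : Fin n} → i Fin.< j → inject₁ i Fin.< inject₁ j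
inject₁-mono-< {i = i} {j} lt rewrite toℕ-inject₁ i | toℕ-inject₁ j = lt

inject₁-cancel-< : ∀ {n} {i j : Fin n} → inject₁ i Fin.< inject₁ j → i Fin.< j
inject₁-cancel-< {i = i} {j} lt rewrite toℕ-inject₁ i | toℕ-inject₁ j = lt

inject₁∈∷ʳ⁺ : ∀ {F : Subset n} {b i} → i ∈ F → inject₁ i ∈ F ∷ʳ b
inject₁∈∷ʳ⁺ {F = _ ∷ _} {i = Fin.zero} here = here
inject₁∈∷ʳ⁺ {F = _ ∷ _} {i = Fin.suc i} (there i∈F) = there (inject₁∈∷ʳ⁺ i∈F)

inject₁∈∷ʳ⁻ : ∀ {F : Subset n} {b i} → inject₁ i ∈ F ∷ʳ b → i ∈ F
inject₁∈∷ʳ⁻ {F = _ ∷ _} {i = Fin.zero} here = here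
inject₁∈∷ʳ⁻ {F = _ ∷ _} {i = Fin.suc i} (there i∈F) = there (inject₁∈∷ʳ⁻ i∈F)

fromℕ∈∷ʳ⁺ : ∀ {F : Subset n} → fromℕ n ∈ F ∷ʳ inside
fromℕ∈∷ʳ⁺ {F = []} = here
fromℕ∈∷ʳ⁺ {F = _ ∷ _} = there fromℕ∈∷ʳ⁺

fromℕ∈∷ʳ⁻ : ∀ {F : Subset n} {b} → fromℕ n ∈ F ∷ʳ b → b ≡ inside
fromℕ∈∷ʳ⁻ {F = []} here = refl
fromℕ∈∷ʳ⁻ {F = _ ∷ _} (there n∈F) = fromℕ∈∷ʳ⁻ n∈F

fromℕ∉∷ʳoutside : ∀ {F : Subset n} → ¬ (fromℕ n ∈ F ∷ʳ outside)
fromℕ∉∷ʳoutside n∈F with () ← fromℕ∈∷ʳ⁻ n∈F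

∣∷ʳoutside∣ : ∀ {n} (F : Subset n) → ∣ F ∷ʳ outside ∣ ≡ ∣ F ∣
∣∷ʳoutside∣ [] = refl
∣∷ʳoutside∣ (inside ∷ F) = cong suc (∣∷ʳoutside∣ F)
∣∷ʳoutside∣ (outside ∷ F) = ∣∷ʳoutside∣ F

∣∷ʳinside∣ : ∀ {n} (F : Subset n) → ∣ F ∷ʳ inside ∣ ≡ suc ∣ F ∣
∣∷ʳinside∣ [] = refl
∣∷ʳinside∣ (inside ∷ F) = cong suc (∣∷ʳinside∣ F)
∣∷ʳinside∣ (outside ∷ F) = ∣∷ʳinside∣ F

<S-irrefl : {F : Subset n} → ¬ (F <S F)
<S-irrefl (_ , x∈F , x∉F , _) = x∉F x∈F

module _ {n : ℕ} {G F : Subset n} where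

  ∷ʳ-⊆⁻ : ∀ {b c} → G ∷ʳ b ⊆ F ∷ʳ c → G ⊆ F
  ∷ʳ-⊆⁻ G⊆F x∈G = inject₁∈∷ʳ⁻ (G⊆F (inject₁∈∷ʳ⁺ x∈G))

  ∷ʳinside-⊆⁻ : ∀ {c} → G ∷ʳ inside ⊆ F ∷ʳ c → c ≡ inside
  ∷ʳinside-⊆⁻ G⊆F = fromℕ∈∷ʳ⁻ (G⊆F fromℕ∈∷ʳ⁺)

  ∷ʳ-<S⁻ : ∀ {b} → (G ∷ʳ b) <S (F ∷ʳ b) → G <S F
  ∷ʳ-<S⁻ {b} (x , x∈F , x∉G , above) with topView x
  ... | top with refl ← fromℕ∈∷ʳ⁻ x∈F = ⊥-elim (x∉G fromℕ∈∷ʳ⁺)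
  ... | below i = i , inject₁∈∷ʳ⁻ x∈F , x∉G ∘ inject₁∈∷ʳ⁺ , λ y i<y →
    let G⇒F , F⇒G = above (inject₁ y) (inject₁-mono-< i<y)
    in inject₁∈∷ʳ⁻ ∘ G⇒F ∘ inject₁∈∷ʳ⁺ , inject₁∈∷ʳ⁻ ∘ F⇒G ∘ inject₁∈∷ʳ⁺

  ∷ʳ-<S⁺ : ∀ {b} → G <S F → (G ∷ʳ b) <S (F ∷ʳ b)
  ∷ʳ-<S⁺ {b} (i , i∈F , i∉G , above) =
    inject₁ i , inject₁∈∷ʳ⁺ i∈F , i∉G ∘ inject₁∈∷ʳ⁻ , above′
    where
    above′ : ∀ y → inject₁ i Fin.< y → (y ∈ G ∷ʳ b → y ∈ F ∷ʳ b) × (y ∈ F ∷ʳ b → y ∈ G ∷ʳ b)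
    above′ y i<y with topView y
    ... | top = (λ y∈G → subst (λ c → fromℕ n ∈ F ∷ʳ c) (sym (fromℕ∈∷ʳ⁻ y∈G)) fromℕ∈∷ʳ⁺)
              , (λ y∈F → subst (λ c → fromℕ n ∈ G ∷ʳ c) (sym (fromℕ∈∷ʳ⁻ y∈F)) fromℕ∈∷ʳ⁺)
    ... | below j = let G⇒F , F⇒G = above j (inject₁-cancel-< i<y)
                    in inject₁∈∷ʳ⁺ ∘ G⇒F ∘ inject₁∈∷ʳ⁻ , inject₁∈∷ʳ⁺ ∘ F⇒G ∘ inject₁∈∷ʳ⁻

  ∷ʳoutside<S∷ʳinside : (G ∷ʳ outside) <S (F ∷ʳ inside)
  ∷ʳoutside<S∷ʳinside = fromℕ n , fromℕ∈∷ʳ⁺ , fromℕ∉∷ʳoutside , λ y n<y → ⊥-elim (fromℕ≮ y n<y)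

  ∷ʳinside≮S∷ʳoutside : ¬ ((G ∷ʳ inside) <S (F ∷ʳ outside))
  ∷ʳinside≮S∷ʳoutside (x , x∈F , _ , above) with topView x
  ... | top     = fromℕ∉∷ʳoutside x∈F
  ... | below i = fromℕ∉∷ʳoutside (proj₁ (above (fromℕ n) (inject₁<fromℕ i)) fromℕ∈∷ʳ⁺)

rankS≡count : ∀ n k F → rankS n k F ≡ count n ((λ G → ∣ G ∣ ≟ k) ∩? (_<S? F))
rankS≡count n k F = length-filter-filter (_<S? F) (λ G → ∣ G ∣ ≟ k) (allSubsets n)

rankS<nCk : ∀ n k {F} → ∣ F ∣ ≡ k → rankS n k F < n C k
rankS<nCk n k {F} ∣F∣≡k = subst (rankS n k F <_) (length-layer n k)
  (filter-notAll (_<S? F) (layer n k)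
    (lose (∈-filter⁺ (λ G → ∣ G ∣ ≟ k) (∈-allSubsets F) ∣F∣≡k) <S-irrefl))

rankS-∷ʳoutside : ∀ n k F → rankS (suc n) k (F ∷ʳ outside) ≡ rankS n k F
rankS-∷ʳoutside n k F = begin
  rankS (suc n) k (F ∷ʳ outside)
    ≡⟨ rankS≡count (suc n) k (F ∷ʳ outside) ⟩
  count (suc n) ((λ G → ∣ G ∣ ≟ k) ∩? (_<S? (F ∷ʳ outside)))
    ≡⟨ count-∷ʳ n ((λ G → ∣ G ∣ ≟ k) ∩? (_<S? (F ∷ʳ outside))) ⟩
  _ ≡⟨ cong₂ _+_
        (length-filter-⇔ _ ((λ G → ∣ G ∣ ≟ k) ∩? (_<S? F)) without-top (allSubsets n))
        (length-filter-none _ (λ _ → ∷ʳinside≮S∷ʳoutside ∘ proj₂) (allSubsets n)) ⟩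
  count n ((λ G → ∣ G ∣ ≟ k) ∩? (_<S? F)) + 0
    ≡⟨ +-identityʳ _ ⟩
  count n ((λ G → ∣ G ∣ ≟ k) ∩? (_<S? F))
    ≡⟨ rankS≡count n k F ⟨
  rankS n k F ∎
  where
  open ≡-Reasoning
  without-top : ∀ G → (∣ G ∷ʳ outside ∣ ≡ k × (G ∷ʳ outside) <S (F ∷ʳ outside)) ⇔ (∣ G ∣ ≡ k × G <S F)
  without-top G = mk⇔ (λ (c , l) → trans (sym (∣∷ʳoutside∣ G)) c , ∷ʳ-<S⁻ l)
                (λ (c , l) → trans (∣∷ʳoutside∣ G) c , ∷ʳ-<S⁺ l)

rankS-∷ʳinside : ∀ n j F → rankS (suc n) (suc j) (F ∷ʳ inside) ≡ n C suc j + rankS n j F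
rankS-∷ʳinside n j F = begin
  rankS (suc n) (suc j) (F ∷ʳ inside)
    ≡⟨ rankS≡count (suc n) (suc j) (F ∷ʳ inside) ⟩
  count (suc n) ((λ G → ∣ G ∣ ≟ suc j) ∩? (_<S? (F ∷ʳ inside)))
    ≡⟨ count-∷ʳ n ((λ G → ∣ G ∣ ≟ suc j) ∩? (_<S? (F ∷ʳ inside))) ⟩
  _ ≡⟨ cong₂ _+_
        (length-filter-⇔ _ (λ G → ∣ G ∣ ≟ suc j) without-top (allSubsets n))
        (length-filter-⇔ _ ((λ G → ∣ G ∣ ≟ j) ∩? (_<S? F)) with-top (allSubsets n)) ⟩
  count n (λ G → ∣ G ∣ ≟ suc j) + count n ((λ G → ∣ G ∣ ≟ j) ∩? (_<S? F))
    ≡⟨ cong₂ _+_ (length-layer n (suc j)) (sym (rankS≡count n j F)) ⟩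
  n C suc j + rankS n j F ∎
  where
  open ≡-Reasoning
  without-top : ∀ G → (∣ G ∷ʳ outside ∣ ≡ suc j × (G ∷ʳ outside) <S (F ∷ʳ inside)) ⇔ ∣ G ∣ ≡ suc j
  without-top G = mk⇔ (λ (c , _) → trans (sym (∣∷ʳoutside∣ G)) c)
                (λ c → trans (∣∷ʳoutside∣ G) c , ∷ʳoutside<S∷ʳinside)
  with-top : ∀ G → (∣ G ∷ʳ inside ∣ ≡ suc j × (G ∷ʳ inside) <S (F ∷ʳ inside)) ⇔ (∣ G ∣ ≡ j × G <S F)
  with-top G = mk⇔ (λ (c , l) → suc-injective (trans (sym (∣∷ʳinside∣ G)) c) , ∷ʳ-<S⁻ l)
                (λ (c , l) → trans (∣∷ʳinside∣ G) (cong suc c) , ∷ʳ-<S⁺ l)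

Initial : (n k m : ℕ) → Subset n → Set
Initial n k m F = ∣ F ∣ ≡ k × rankS n k F < m

initial? : ∀ n k m → Decidable (Initial n k m)
initial? n k m F = (∣ F ∣ ≟ k) ×-dec (rankS n k F <? m)

∈-firstS⇔ : ∀ {n k m F} → F ∈ₗ firstS n k m ⇔ Initial n k m F
∈-firstS⇔ {n} {k} {m} {F} = mk⇔
  (λ F∈ → let F∈layer , r<m = ∈-filter⁻ (λ G → rankS n k G <? m) {xs = layer n k} F∈
          in proj₂ (∈-filter⁻ (λ G → ∣ G ∣ ≟ k) {xs = allSubsets n} F∈layer) , r<m)
  (λ (c , r<m) → ∈-filter⁺ (λ G → rankS n k G <? m)
                   (∈-filter⁺ (λ G → ∣ G ∣ ≟ k) (∈-allSubsets F) c) r<m)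

length-firstS : ∀ n k m → length (firstS n k m) ≡ count n (initial? n k m)
length-firstS n k m = length-filter-filter (λ F → rankS n k F <? m) (λ F → ∣ F ∣ ≟ k) (allSubsets n)

Initial-∷ʳoutside : ∀ {n k m} F → Initial (suc n) k m (F ∷ʳ outside) ⇔ Initial n k m F
Initial-∷ʳoutside {n} {k} {m} F = mk⇔
  (λ (c , r<m) → trans (sym (∣∷ʳoutside∣ F)) c , subst (_< m) (rankS-∷ʳoutside n k F) r<m)
  (λ (c , r<m) → trans (∣∷ʳoutside∣ F) c , subst (_< m) (sym (rankS-∷ʳoutside n k F)) r<m)

Initial-∷ʳinside : ∀ {n j m} F → Initial (suc n) (suc j) m (F ∷ʳ inside) ⇔ Initial n j (m ∸ n C suc j) F
Initial-∷ʳinside {n} {j} {m} F = mk⇔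
  (λ (c , r<m) → suc-injective (trans (sym (∣∷ʳinside∣ F)) c)
               , to (m+n<o⇔n<o∸m (n C suc j)) (subst (_< m) (rankS-∷ʳinside n j F) r<m))
  (λ (c , r<m) → trans (∣∷ʳinside∣ F) (cong suc c)
               , subst (_< m) (sym (rankS-∷ʳinside n j F)) (from (m+n<o⇔n<o∸m (n C suc j)) r<m))

¬Initial-∷ʳinside : ∀ {n j m} F → m ≤ n C suc j → ¬ Initial (suc n) (suc j) m (F ∷ʳ inside)
¬Initial-∷ʳinside {n} {j} {m} F m≤C F∈
  with () ← subst (rankS n j F <_) (m≤n⇒m∸n≡0 m≤C) (proj₂ (to (Initial-∷ʳinside F) F∈))

length-firstS-suc : ∀ n j m →
  length (firstS (suc n) (suc j) m) ≡ length (firstS n (suc j) m) + length (firstS n j (m ∸ n C suc j))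
length-firstS-suc n j m = begin
  length (firstS (suc n) (suc j) m)
    ≡⟨ length-firstS (suc n) (suc j) m ⟩
  count (suc n) (initial? (suc n) (suc j) m)
    ≡⟨ count-∷ʳ n (initial? (suc n) (suc j) m) ⟩
  _ ≡⟨ cong₂ _+_ (length-filter-⇔ _ (initial? n (suc j) m) Initial-∷ʳoutside (allSubsets n))
                 (length-filter-⇔ _ (initial? n j (m ∸ n C suc j)) Initial-∷ʳinside (allSubsets n)) ⟩
  count n (initial? n (suc j) m) + count n (initial? n j (m ∸ n C suc j))
    ≡⟨ cong₂ _+_ (length-firstS n (suc j) m) (length-firstS n j (m ∸ n C suc j)) ⟨
  length (firstS n (suc j) m) + length (firstS n j (m ∸ n C suc j)) ∎
  where open ≡-Reasoning

length-firstS-all : ∀ n k {m} → n C k ≤ m → length (firstS n k m) ≡ n C k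
length-firstS-all n k C≤m = trans (length-firstS n k _)
  (trans (length-filter-⇔ _ (λ F → ∣ F ∣ ≟ k)
           (λ F → mk⇔ proj₁ (λ c → c , <-≤-trans (rankS<nCk n k c) C≤m)) (allSubsets n))
         (length-layer n k))

length-firstS-0 : ∀ n k → length (firstS n k 0) ≡ 0
length-firstS-0 n k = trans (length-firstS n k 0) (length-filter-none _ (λ _ ()) (allSubsets n))

InShadow : (n k m : ℕ) → Subset n → Set
InShadow n k m H = Any (H ⊆_) (firstS n k m)

inShadow? : ∀ n k m → Decidable (InShadow n k m)
inShadow? n k m H = any? (H ⊆?_) (firstS n k m)

shadowSize : (n k m : ℕ) → ℕ
shadowSize n k m = length (filter (inShadow? n k m) (layer n (k ∸ 1)))

shadowSize+length-complShadow : ∀ n k m → shadowSize n k m + length (complShadow n k m) ≡ n C (k ∸ 1)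
shadowSize+length-complShadow n k m =
  trans (length-filter+length-filter-¬ (inShadow? n k m) (layer n (k ∸ 1))) (length-layer n (k ∸ 1))

shadowSize-∷ʳ : ∀ n k m → shadowSize (suc n) k m ≡
  count n (λ H → (∣ H ∷ʳ outside ∣ ≟ k ∸ 1) ×-dec inShadow? (suc n) k m (H ∷ʳ outside)) +
  count n (λ H → (∣ H ∷ʳ inside ∣ ≟ k ∸ 1) ×-dec inShadow? (suc n) k m (H ∷ʳ inside))
shadowSize-∷ʳ n k m =
  trans (length-filter-filter (inShadow? (suc n) k m) (λ H → ∣ H ∣ ≟ k ∸ 1) (allSubsets (suc n)))
        (count-∷ʳ n ((λ H → ∣ H ∣ ≟ k ∸ 1) ∩? inShadow? (suc n) k m))

InShadow⁺ : ∀ {n k m H G} → Initial n k m G → H ⊆ G → InShadow n k m H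
InShadow⁺ G∈𝒜 H⊆G = lose (from ∈-firstS⇔ G∈𝒜) H⊆G

InShadow-∷ʳ⁻ : ∀ {n k m} H′ → InShadow (suc n) k m H′ →
  ∃[ G ] ∃[ c ] Initial (suc n) k m (G ∷ʳ c) × H′ ⊆ G ∷ʳ c
InShadow-∷ʳ⁻ H′ H′∈∂𝒜 with find H′∈∂𝒜
... | G′ , G′∈𝒜 , H′⊆G′ with initLast G′
...   | G , c , refl = G , c , to ∈-firstS⇔ G′∈𝒜 , H′⊆G′

length-shadow₀≤length : ∀ {n} (Fs : List (Subset n)) →
  length (filter (λ H → any? (H ⊆?_) Fs) (layer n 0)) ≤ length Fs
length-shadow₀≤length {n} [] = ≤-reflexive (length-filter-none _ (λ _ ()) (layer n 0))
length-shadow₀≤length {n} (_ ∷ _) =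
  ≤-trans (length-filter _ (layer n 0)) (≤-trans (≤-reflexive (length-layer n 0)) (s≤s z≤n))

shadowSize-suc≤shadowSize : ∀ n j m → m ≤ n C suc (suc j) →
  shadowSize (suc n) (suc (suc j)) m ≤ shadowSize n (suc (suc j)) m
shadowSize-suc≤shadowSize n j m m≤C = begin
  shadowSize (suc n) K m
    ≡⟨ shadowSize-∷ʳ n K m ⟩
  count n _ + count n _
    ≤⟨ +-mono-≤ (length-filter-mono _ ((λ H → ∣ H ∣ ≟ suc j) ∩? inShadow? n K m) without-top (allSubsets n))
                (≤-reflexive (length-filter-none _ with-top (allSubsets n))) ⟩
  count n ((λ H → ∣ H ∣ ≟ suc j) ∩? inShadow? n K m) + 0
    ≡⟨ +-identityʳ _ ⟩
  count n ((λ H → ∣ H ∣ ≟ suc j) ∩? inShadow? n K m)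
    ≡⟨ length-filter-filter (inShadow? n K m) (λ H → ∣ H ∣ ≟ suc j) (allSubsets n) ⟨
  shadowSize n K m ∎
  where
  open ≤-Reasoning
  K = suc (suc j)
  without-top : ∀ H → ∣ H ∷ʳ outside ∣ ≡ suc j × InShadow (suc n) K m (H ∷ʳ outside) →
                ∣ H ∣ ≡ suc j × InShadow n K m H
  without-top H (c , H∈∂𝒜) with InShadow-∷ʳ⁻ (H ∷ʳ outside) H∈∂𝒜
  ... | G , inside  , G∈𝒜 , _   = contradiction G∈𝒜 (¬Initial-∷ʳinside G m≤C)
  ... | G , outside , G∈𝒜 , H⊆G =
    trans (sym (∣∷ʳoutside∣ H)) c , InShadow⁺ (to (Initial-∷ʳoutside G) G∈𝒜) (∷ʳ-⊆⁻ H⊆G)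
  with-top : ∀ H → ¬ (∣ H ∷ʳ inside ∣ ≡ suc j × InShadow (suc n) K m (H ∷ʳ inside))
  with-top H (_ , H∈∂𝒜) with InShadow-∷ʳ⁻ (H ∷ʳ inside) H∈∂𝒜
  ... | G , c , G∈𝒜 , H⊆G with refl ← ∷ʳinside-⊆⁻ H⊆G = ¬Initial-∷ʳinside G m≤C G∈𝒜

shadowSize-suc≤nC[j+1]+shadowSize : ∀ n j m →
  shadowSize (suc n) (suc (suc j)) m ≤ n C suc j + shadowSize n (suc j) (m ∸ n C suc (suc j))
shadowSize-suc≤nC[j+1]+shadowSize n j m = begin
  shadowSize (suc n) K m
    ≡⟨ shadowSize-∷ʳ n K m ⟩
  count n _ + count n _
    ≤⟨ +-mono-≤ (length-filter-mono _ (λ H → ∣ H ∣ ≟ suc j)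
                   (λ H → trans (sym (∣∷ʳoutside∣ H)) ∘ proj₁) (allSubsets n))
                (length-filter-mono _ ((λ H → ∣ H ∣ ≟ j) ∩? inShadow? n (suc j) m′) with-top (allSubsets n)) ⟩
  count n (λ H → ∣ H ∣ ≟ suc j) + count n ((λ H → ∣ H ∣ ≟ j) ∩? inShadow? n (suc j) m′)
    ≡⟨ cong₂ _+_ (length-layer n (suc j))
                 (sym (length-filter-filter (inShadow? n (suc j) m′) (λ H → ∣ H ∣ ≟ j) (allSubsets n))) ⟩
  n C suc j + shadowSize n (suc j) m′ ∎
  where
  open ≤-Reasoning
  K = suc (suc j)
  m′ = m ∸ n C K
  with-top : ∀ H → ∣ H ∷ʳ inside ∣ ≡ suc j × InShadow (suc n) K m (H ∷ʳ inside) →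
             ∣ H ∣ ≡ j × InShadow n (suc j) m′ H
  with-top H (c , H∈∂𝒜) with InShadow-∷ʳ⁻ (H ∷ʳ inside) H∈∂𝒜
  ... | G , c′ , G∈𝒜 , H⊆G with refl ← ∷ʳinside-⊆⁻ H⊆G =
    suc-injective (trans (sym (∣∷ʳinside∣ H)) c) , InShadow⁺ (to (Initial-∷ʳinside G) G∈𝒜) (∷ʳ-⊆⁻ H⊆G)

-- If m ≤ C(n,k), the first m k-subsets of [n+1] avoid n+1. Otherwise they are all k-subsets of [n]
-- together with G ∪ {n+1} for the first m − C(n,k) (k−1)-subsets G of [n]; compared with the
-- excess of those G, the shadow gains at most C(n,k−1) sets while the family gains C(n,k).
excessBound : ℕ → ℕ → ℕ
excessBound zero k = 0
excessBound (suc n) zero = 0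
excessBound (suc n) (suc zero) = 0
excessBound (suc n) (suc (suc j)) =
  excessBound n (suc (suc j)) ⊔ ((n C suc j + excessBound n (suc j)) ∸ n C suc (suc j))

shadowSize≤length-firstS+excessBound : ∀ n k m → shadowSize n k m ≤ length (firstS n k m) + excessBound n k
shadowSize≤length-firstS+excessBound n zero m =
  ≤-trans (length-shadow₀≤length (firstS n 0 m)) (m≤m+n _ _)
shadowSize≤length-firstS+excessBound n (suc zero) m =
  ≤-trans (length-shadow₀≤length (firstS n 1 m)) (m≤m+n _ _)
shadowSize≤length-firstS+excessBound zero (suc (suc j)) m =
  ≤-trans (length-filter (inShadow? 0 (suc (suc j)) m) (layer 0 (suc j))) z≤n
shadowSize≤length-firstS+excessBound (suc n) (suc (suc j)) m with m ≤? n C suc (suc j)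
... | yes m≤C = begin
  shadowSize (suc n) K m
    ≤⟨ shadowSize-suc≤shadowSize n j m m≤C ⟩
  shadowSize n K m
    ≤⟨ shadowSize≤length-firstS+excessBound n K m ⟩
  length (firstS n K m) + excessBound n K
    ≤⟨ +-mono-≤ (m≤m+n _ (length (firstS n (suc j) m′))) (m≤m⊔n (excessBound n K) _) ⟩
  (length (firstS n K m) + length (firstS n (suc j) m′)) + excessBound (suc n) K
    ≡⟨ cong (_+ excessBound (suc n) K) (length-firstS-suc n (suc j) m) ⟨
  length (firstS (suc n) K m) + excessBound (suc n) K ∎
  where
  open ≤-Reasoning
  K = suc (suc j)
  m′ = m ∸ n C K
... | no m≰C = begin
  shadowSize (suc n) K m
    ≤⟨ shadowSize-suc≤nC[j+1]+shadowSize n j m ⟩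
  n C suc j + shadowSize n (suc j) m′
    ≤⟨ +-monoʳ-≤ (n C suc j) (shadowSize≤length-firstS+excessBound n (suc j) m′) ⟩
  n C suc j + (length (firstS n (suc j) m′) + excessBound n (suc j))
    ≤⟨ m+[n+o]≤[p+n]+[q⊔[m+o∸p]] (n C suc j) _ (excessBound n (suc j)) (n C K) (excessBound n K) ⟩
  (n C K + length (firstS n (suc j) m′)) + excessBound (suc n) K
    ≡⟨ cong (λ a → (a + length (firstS n (suc j) m′)) + excessBound (suc n) K)
            (length-firstS-all n K (≰⇒≥ m≰C)) ⟨
  (length (firstS n K m) + length (firstS n (suc j) m′)) + excessBound (suc n) K
    ≡⟨ cong (_+ excessBound (suc n) K) (length-firstS-suc n (suc j) m) ⟨
  length (firstS (suc n) K m) + excessBound (suc n) K ∎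
  where
  open ≤-Reasoning
  K = suc (suc j)
  m′ = m ∸ n C K

nC[k∸1]≤fsfaSize+excessBound : ∀ n k m → n C (k ∸ 1) ≤ fsfaSize n k m + excessBound n k
nC[k∸1]≤fsfaSize+excessBound n k m = begin
  n C (k ∸ 1)                        ≡⟨ shadowSize+length-complShadow n k m ⟨
  shadowSize n k m + ∣𝓑∣             ≤⟨ +-monoˡ-≤ ∣𝓑∣ (shadowSize≤length-firstS+excessBound n k m) ⟩
  (∣𝒜∣ + excessBound n k) + ∣𝓑∣      ≡⟨ xy∙z≈xz∙y ∣𝒜∣ (excessBound n k) ∣𝓑∣ ⟩
  fsfaSize n k m + excessBound n k ∎
  where
  open ≤-Reasoning
  ∣𝒜∣ = length (firstS n k m)
  ∣𝓑∣ = length (complShadow n k m)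

fsfaSize-0≤nC[k∸1] : ∀ n k → fsfaSize n k 0 ≤ n C (k ∸ 1)
fsfaSize-0≤nC[k∸1] n k = begin
  length (firstS n k 0) + length (complShadow n k 0)
    ≡⟨ cong (_+ length (complShadow n k 0)) (length-firstS-0 n k) ⟩
  length (complShadow n k 0)
    ≤⟨ length-filter _ (layer n (k ∸ 1)) ⟩
  length (layer n (k ∸ 1))
    ≡⟨ length-layer n (k ∸ 1) ⟩
  n C (k ∸ 1) ∎
  where open ≤-Reasoning

s≤fsfaSize-0 : ∀ n k → s n k ≤ fsfaSize n k 0
s≤fsfaSize-0 n k = foldr-preservesʳ {P = _≤ fsfaSize n k 0}
  (λ x → ≤-trans (m⊓n≤n x _)) ≤-refl (map (fsfaSize n k) (upTo (suc (n C k))))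

≤fsfaSize⇒≤s : ∀ n k {b} → (∀ m → b ≤ fsfaSize n k m) → b ≤ s n k
≤fsfaSize⇒≤s n k {b} b≤ = foldr-preservesᵇ {P = b ≤_} ⊓-glb (b≤ 0) (map⁺ (universal b≤ (upTo (suc (n C k)))))

∣s-nC[k∸1]∣≤excessBound : ∀ n k → ∣ s n k - n C (k ∸ 1) ∣ ≤ excessBound n k
∣s-nC[k∸1]∣≤excessBound n k = begin
  ∣ s n k - b ∣  ≡⟨ m≤n⇒∣m-n∣≡n∸m s≤b ⟩
  b ∸ s n k      ≤⟨ m≤n+o⇒m∸n≤o b (s n k) b≤s+E ⟩
  E ∎
  where
  open ≤-Reasoning
  b = n C (k ∸ 1)
  E = excessBound n k
  s≤b : s n k ≤ b
  s≤b = ≤-trans (s≤fsfaSize-0 n k) (fsfaSize-0≤nC[k∸1] n k)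
  b∸E≤s : b ∸ E ≤ s n k
  b∸E≤s = ≤fsfaSize⇒≤s n k λ m →
    ≤-trans (∸-monoˡ-≤ E (nC[k∸1]≤fsfaSize+excessBound n k m)) (≤-reflexive (m+n∸n≡m _ E))
  b≤s+E : b ≤ s n k + E
  b≤s+E = begin
    b             ≤⟨ m≤n+m∸n b E ⟩
    E + (b ∸ E)   ≤⟨ +-monoʳ-≤ E b∸E≤s ⟩
    E + s n k     ≡⟨ +-comm E (s n k) ⟩
    s n k + E ∎

excessBound-1 : ∀ n → excessBound n 1 ≡ 0
excessBound-1 zero = refl
excessBound-1 (suc n) = refl

shift-central-bound : ∀ h e → suc (suc h) * e ≤ 2 * ((suc h + suc h) C suc h) →
  suc (suc (suc h)) * e ≤ (suc (suc h) + suc (suc h)) C suc (suc h)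
shift-central-bound h e bound = *-cancelˡ-≤ (suc (suc h)) (begin
  suc (suc h) * (suc (suc (suc h)) * e)   ≡⟨ ring₁ h e ⟩
  suc (suc (suc h)) * (suc (suc h) * e)   ≤⟨ *-monoʳ-≤ (suc (suc (suc h))) bound ⟩
  suc (suc (suc h)) * (2 * X)             ≤⟨ *-monoˡ-≤ (2 * X) (s≤s (s≤s (m≤n+m (suc h) h))) ⟩
  suc (suc h + suc h) * (2 * X)           ≡⟨ ring₂ (suc h + suc h) X ⟩
  2 * suc (suc h + suc h) * X             ≡⟨ [i+1]*[2i+2]C[i+1]≡2*[2i+1]*[2i]Ci (suc h) ⟨
  suc (suc h) * ((suc (suc h) + suc (suc h)) C suc (suc h)) ∎)
  where
  open ≤-Reasoning
  X = (suc h + suc h) C suc h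
  ring₁ : ∀ h e → suc (suc h) * (suc (suc (suc h)) * e) ≡ suc (suc (suc h)) * (suc (suc h) * e)
  ring₁ = solve-∀
  ring₂ : ∀ c x → suc c * (2 * x) ≡ 2 * suc c * x
  ring₂ = solve-∀

[j+1]*excessBound≤2*[2j]Cj : ∀ n j → suc j * excessBound n (suc j) ≤ 2 * ((j + j) C j)
[j+1]*excessBound≤2*[2j]Cj zero j = ≤-trans (≤-reflexive (*-zeroʳ (suc j))) z≤n
[j+1]*excessBound≤2*[2j]Cj (suc n) zero = z≤n
[j+1]*excessBound≤2*[2j]Cj (suc n) (suc i) = begin
  K * (excessBound n K ⊔ Y)            ≡⟨ *-distribˡ-⊔ K (excessBound n K) Y ⟩
  K * excessBound n K ⊔ K * Y          ≤⟨ ⊔-lub ([j+1]*excessBound≤2*[2j]Cj n (suc i)) K*Y≤2X ⟩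
  2 * X ∎
  where
  open ≤-Reasoning
  K = suc (suc i)
  Y = (n C suc i + excessBound n (suc i)) ∸ n C K
  X = (suc i + suc i) C suc i
  [i+2]*excessBound≤X : ∀ j → suc (suc j) * excessBound n (suc j) ≤ (suc j + suc j) C suc j
  [i+2]*excessBound≤X zero rewrite excessBound-1 n = z≤n
  [i+2]*excessBound≤X (suc h) =
    shift-central-bound h (excessBound n (suc (suc h))) ([j+1]*excessBound≤2*[2j]Cj n (suc h))
  K*Y≤2X : K * Y ≤ 2 * X
  K*Y≤2X = begin
    K * Y
      ≤⟨ *-monoʳ-≤ K ([m+n]∸o≤[m∸o]+n (n C suc i) (excessBound n (suc i)) (n C K)) ⟩
    K * ((n C suc i ∸ n C K) + excessBound n (suc i))
      ≡⟨ *-distribˡ-+ K (n C suc i ∸ n C K) (excessBound n (suc i)) ⟩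
    K * (n C suc i ∸ n C K) + K * excessBound n (suc i)
      ≡⟨ cong (_+ K * excessBound n (suc i)) ([k+1]*[nCk∸nC[k+1]]≡gap (suc i) n) ⟩
    gap (suc i) n + K * excessBound n (suc i)
      ≤⟨ +-mono-≤ (gap≤[k+k]Ck (suc i) n) ([i+2]*excessBound≤X i) ⟩
    X + X
      ≡⟨ cong (X +_) (+-identityʳ X) ⟨
    2 * X ∎

-- For k ≥ 2d the bound k·excess ≤ 2·C(2k−2,k−1) ≤ 2·C(n,k−1) suffices; for k < 2d the excess is
-- at most 2·C(4d,2d), while C(n,k−1) ≥ n.
threshold : ℕ → ℕ
threshold d = suc (d * (2 * (((d + d) + (d + d)) C (d + d))))

d*excessBound≤nC[k∸1] : ∀ d n k → threshold d ≤ n → 1 ≤ k → 2 * k ≤ suc n → d * excessBound n k ≤ n C (k ∸ 1)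
d*excessBound≤nC[k∸1] d n (suc zero) _ _ _ rewrite excessBound-1 n | *-zeroʳ d = z≤n
d*excessBound≤nC[k∸1] d n (suc (suc i)) N≤n _ 2k≤n+1 with 2 * d ≤? suc (suc i)
... | yes 2d≤k = *-cancelˡ-≤ 2 (begin
  2 * (d * e)                    ≡⟨ *-assoc 2 d e ⟨
  (2 * d) * e                    ≤⟨ *-monoˡ-≤ e 2d≤k ⟩
  suc (suc i) * e                ≤⟨ [j+1]*excessBound≤2*[2j]Cj n (suc i) ⟩
  2 * ((suc i + suc i) C suc i)  ≤⟨ *-monoʳ-≤ 2 (C-monoˡ-≤ (suc i) 2i+2≤n) ⟩
  2 * (n C suc i) ∎)
  where
  open ≤-Reasoning
  e = excessBound n (suc (suc i))
  2i+2≤n : suc i + suc i ≤ n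
  2i+2≤n = 2*[i+2]≤1+n⇒[i+1]+[i+1]≤n i 2k≤n+1
... | no 2d≰k = begin
  d * e                                      ≤⟨ *-monoʳ-≤ d (m≤n*m e (suc (suc i))) ⟩
  d * (suc (suc i) * e)                      ≤⟨ *-monoʳ-≤ d ([j+1]*excessBound≤2*[2j]Cj n (suc i)) ⟩
  d * (2 * ((suc i + suc i) C suc i))        ≤⟨ *-monoʳ-≤ d (*-monoʳ-≤ 2 (central-mono-≤ i+1≤2d)) ⟩
  d * (2 * (((d + d) + (d + d)) C (d + d)))  <⟨ n<1+n _ ⟩
  threshold d                                ≤⟨ N≤n ⟩
  n                                          ≤⟨ n≤nCk (s≤s z≤n) i+1<n ⟩
  n C suc i ∎
  where
  open ≤-Reasoning
  e = excessBound n (suc (suc i))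
  i+1≤2d : suc i ≤ d + d
  i+1≤2d = ≤-trans (≤-trans (n≤1+n (suc i)) (n≤1+n _))
    (subst (suc (suc (suc i)) ≤_) (cong (d +_) (+-identityʳ d)) (≰⇒> 2d≰k))
  i+1<n : suc i < n
  i+1<n = ≤-trans (s≤s (m≤n+m (suc i) i)) (2*[i+2]≤1+n⇒[i+1]+[i+1]≤n i 2k≤n+1)

corollary11 : (k : ℕ → ℕ) →
    ((n : ℕ) → 1 ≤ n → (1 ≤ k n) × (2 * k n ≤ suc n)) →
    (d : ℕ) → ∃[ N ] ((n : ℕ) → N ≤ n →
      d * ∣ s n (k n) - (n C (k n ∸ 1)) ∣ ≤ n C (k n ∸ 1))
corollary11 k k-range d = threshold d , λ n N≤n →
  let 1≤k , 2k≤n+1 = k-range n (≤-trans (s≤s z≤n) N≤n)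
  in ≤-trans (*-monoʳ-≤ d (∣s-nC[k∸1]∣≤excessBound n (k n)))
             (d*excessBound≤nC[k∸1] d n (k n) N≤n 1≤k 2k≤n+1)
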